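{- The scheduling game on $2$ unrelated machines under the RANDOM policy is a potential game: for any $n$ jobs with arbitrary processing times $p_{i,j}>0$ ($1\le i\le n$, $j\in\{1,2\}$), starting from any strategy profile, every sequence of better-response moves is finite.
   Context: Scheduling game: each job is a player choosing one machine; a strategy profile is a map $\sigma:\{1,\dots,n\}\to\{1,2\}$; $p_{i,j}$ is the processing time of job $i$ on machine $j$ (unrelated machines: arbitrary values). Under the RANDOM policy (jobs on a machine are processed in uniformly random order, without preemption), the cost of job $i$ with $\sigma(i)=j$ is $c_i(\sigma)=p_{i,j}+\frac12\sum_{i'\neq i:\ \sigma(i')=j}p_{i',j}$. A better-response move is a change of machine by a single job, all others fixed, that strictly decreases that job's cost. A potential game is one in which the better-response dynamic always converges.
   Formalization: The processing times $p_{i,j}$ are rational numbers. -}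

module Defs where

open import Data.Nat using (ℕ; zero; suc)
open import Data.Fin using (Fin; zero; suc; _≟_)
open import Data.Rational using (ℚ; 0ℚ; ½; _+_; _*_; _<_)
open import Data.Product using (∃; _×_)
open import Relation.Binary.PropositionalEquality using (_≡_; _≢_)
open import Relation.Nullary using (yes; no)

Machine : Set
Machine = Fin 2

Profile : ℕ → Set
Profile n = Fin n → Machine

Times : ℕ → Set
Times n = Fin n → Machine → ℚ

Σ[<_]_ : (n : ℕ) → (Fin n → ℚ) → ℚ
Σ[< zero ] f = 0ℚ
Σ[< suc n ] f = f zero + Σ[< n ] (λ k → f (suc k))

other : ∀ {n} → Times n → Profile n → Fin n → Fin n → ℚ
other p σ i i' with i' ≟ i | σ i' ≟ σ i
... | yes _ | _     = 0ℚ
... | no _  | yes _ = p i' (σ i)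
... | no _  | no _  = 0ℚ

cost : ∀ {n} → Times n → Profile n → Fin n → ℚ
cost {n} p σ i = p i (σ i) + ½ * (Σ[< n ] other p σ i)

BetterResponse : ∀ {n} → Times n → Profile n → Profile n → Set
BetterResponse p σ σ' =
  ∃ λ i → (∀ k → k ≢ i → σ' k ≡ σ k) × (σ' i ≢ σ i) × (cost p σ' i < cost p σ i)

{-# OPTIONS --safe #-}
module Submission where

-- With L₁, L₂ the machine loads, Φ(σ) = (L₁ − L₂)² + 3 Σₖ p_{k,σ(k)}² is a weighted potential:
-- when job i moves from machine a to machine b, Φ drops by exactly
-- 4 (p_{i,a} + p_{i,b}) (c_i(σ) − c_i(σ')), which is positive for a better response.
-- Φ takes at most 2ⁿ values, so it cannot decrease forever.

open import Defs
open import Data.Nat using (ℕ; zero; suc)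
open import Data.Rational using (0ℚ; _<_)
open import Induction.WellFounded using (Acc)
open import Function using (flip)

open import Agda.Builtin.FromNat using (Number; fromNat)
open import Algebra.Bundles using (CommutativeMonoid)
open import Data.Bool using (if_then_else_)
open import Data.Fin using (Fin; zero; suc; _≟_; finToFun; funToFin)
open import Data.Fin.Properties using (finToFun-funToFin)
open import Data.List using (List; []; _∷_; map; allFin)
open import Data.List.Membership.Propositional using (_∈_)
open import Data.List.Membership.Propositional.Properties using (∈-map⁺; ∈-allFin)
open import Data.List.Relation.Unary.Any using (here; there)
import Data.Nat as ℕ
open import Data.Nat.Induction using (<-wellFounded)
import Data.Nat.Properties as ℕ
open import Data.Product using (_,_)
open import Data.Rational using (ℚ; ½; _+_; _*_; _-_; -_; _≤_; _<?_; Positive; positive)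
open import Data.Rational.Literals using (number)
open import Data.Rational.Properties
  using ( +-*-commutativeRing; +-0-group; +-0-commutativeMonoid; +-identityˡ
        ; <-irrefl; <-trans; <⇒≤; <-≤-trans; +-monoˡ-<; +-monoʳ-<; *-monoʳ-<-pos
        ; pos+pos⇒pos; pos*pos⇒pos; module ≤-Reasoning)
  renaming (_≟_ to _≟ℚ_)
open import Algebra.Properties.Group +-0-group using (//-rightDividesʳ)
open import Algebra.Properties.CommutativeSemigroup
  (CommutativeMonoid.commutativeSemigroup +-0-commutativeMonoid) using (x∙yz≈y∙xz)
open import Data.Unit using (tt)
open import Function using (_∘_; _on_)
open import Induction.WellFounded using (WellFounded; module Subrelation)
open import Level using (0ℓ)
import Relation.Binary.Construct.On as On
open import Relation.Binary.PropositionalEquality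
open import Relation.Nullary using (yes; no; does; dec⇒maybe)
open import Relation.Nullary.Negation using (contradiction)
open import Tactic.RingSolver using (solve-∀)
open import Tactic.RingSolver.Core.AlmostCommutativeRing using (AlmostCommutativeRing; fromCommutativeRing)

instance
  ℚ-number : Number ℚ
  ℚ-number = number

ℚ-ring : AlmostCommutativeRing 0ℓ 0ℓ
ℚ-ring = fromCommutativeRing +-*-commutativeRing (λ q → dec⇒maybe (0ℚ ≟ℚ q))

+-cancelʳ-< : ∀ r {p q} → p + r < q + r → p < q
+-cancelʳ-< r {p} {q} = subst₂ _<_ (//-rightDividesʳ r p) (//-rightDividesʳ r q) ∘ +-monoˡ-< (- r)

Σ-cong : ∀ {n} {f g : Fin n → ℚ} → f ≗ g → Σ[< n ] f ≡ Σ[< n ] g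
Σ-cong {zero}  f≗g = refl
Σ-cong {suc n} f≗g = cong₂ _+_ (f≗g zero) (Σ-cong (f≗g ∘ suc))

except : ∀ {n} → Fin n → (Fin n → ℚ) → Fin n → ℚ
except i f k = if does (k ≟ i) then 0ℚ else f k

Σ-except : ∀ {n} (f : Fin n → ℚ) i → Σ[< n ] f ≡ f i + Σ[< n ] except i f
Σ-except {suc n} f zero    = cong (f zero +_) (sym (+-identityˡ _))
Σ-except {suc n} f (suc i) = trans (cong (f zero +_) (Σ-except (f ∘ suc) i)) (x∙yz≈y∙xz (f zero) (f (suc i)) _)

Σ-except-cong : ∀ {n} {f g : Fin n → ℚ} i → (∀ k → k ≢ i → f k ≡ g k) →
                Σ[< n ] except i f ≡ Σ[< n ] except i g
Σ-except-cong {f = f} {g} i f≡g = Σ-cong pointwise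
  where
  pointwise : ∀ k → except i f k ≡ except i g k
  pointwise k with k ≟ i
  ... | yes _  = refl
  ... | no k≢i = f≡g k k≢i

countBelow : ℚ → List ℚ → ℕ
countBelow r []       = zero
countBelow r (v ∷ vs) with v <? r
... | yes _ = suc (countBelow r vs)
... | no _  = countBelow r vs

countBelow-mono : ∀ vs {r s} → r ≤ s → countBelow r vs ℕ.≤ countBelow s vs
countBelow-mono []       r≤s = ℕ.z≤n
countBelow-mono (v ∷ vs) {r} {s} r≤s with v <? r | v <? s
... | yes _   | yes _   = ℕ.s≤s (countBelow-mono vs r≤s)
... | yes v<r | no v≮s  = contradiction (<-≤-trans v<r r≤s) v≮s
... | no _    | yes _   = ℕ.m≤n⇒m≤1+n (countBelow-mono vs r≤s)
... | no _    | no _    = countBelow-mono vs r≤s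

countBelow-strict : ∀ {vs r s} → r ∈ vs → r < s → countBelow r vs ℕ.< countBelow s vs
countBelow-strict {v ∷ vs} {r} {s} (here r≡v) r<s with v <? r | v <? s
... | yes v<r | _      = contradiction v<r (<-irrefl (sym r≡v))
... | no _    | yes _  = ℕ.s≤s (countBelow-mono vs (<⇒≤ r<s))
... | no _    | no v≮s = contradiction (subst (_< s) r≡v r<s) v≮s
countBelow-strict {v ∷ vs} {r} {s} (there r∈vs) r<s with v <? r | v <? s
... | yes _   | yes _  = ℕ.s≤s (countBelow-strict r∈vs r<s)
... | yes v<r | no v≮s = contradiction (<-trans v<r r<s) v≮s
... | no _    | yes _  = ℕ.m≤n⇒m≤1+n (countBelow-strict r∈vs r<s)
... | no _    | no _   = countBelow-strict r∈vs r<s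

wellFounded-finiteImage : ∀ {A : Set} (f : A → ℚ) {vs : List ℚ} → (∀ a → f a ∈ vs) → WellFounded (_<_ on f)
wellFounded-finiteImage {A} f {vs} f∈vs =
  Subrelation.wellFounded (λ {a} → countBelow-strict (f∈vs a)) (On.wellFounded rank <-wellFounded)
  where
  rank : A → ℕ
  rank a = countBelow (f a) vs

Φ : ℚ → ℚ → ℚ → ℚ
Φ u v q = (u - v) * (u - v) + 3 * q

Φ-swap : ∀ u v q → (u - v) * (u - v) + 3 * q ≡ (v - u) * (v - u) + 3 * q
Φ-swap = solve-∀ ℚ-ring

-- Job i has length x on its old machine and y on its new one, A and B are the loads of the
-- other jobs on these machines and R their sum of squares; the last summands are 4 (x + y)
-- times the cost of i after and before the move.
Φ-move : ∀ x y A B R →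
         (x + A - B) * (x + A - B) + 3 * (x * x + R) + 4 * (x + y) * (y + ½ * B) ≡
         (y + B - A) * (y + B - A) + 3 * (y * y + R) + 4 * (x + y) * (x + ½ * A)
Φ-move = solve-∀ ℚ-ring

module Potential {n : ℕ} (p : Times n) where

  contribution : Fin n → Machine → Machine → ℚ
  contribution k m j = if does (m ≟ j) then p k j else 0ℚ

  load : Profile n → Machine → ℚ
  load σ j = Σ[< n ] λ k → contribution k (σ k) j

  loadExcept : Profile n → Fin n → Machine → ℚ
  loadExcept σ i j = Σ[< n ] except i λ k → contribution k (σ k) j

  square : Profile n → Fin n → ℚ
  square σ k = p k (σ k) * p k (σ k)

  sumSq : Profile n → ℚ
  sumSq σ = Σ[< n ] square σ

  sumSqExcept : Profile n → Fin n → ℚ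
  sumSqExcept σ i = Σ[< n ] except i (square σ)

  potential : Profile n → ℚ
  potential σ = Φ (load σ zero) (load σ (suc zero)) (sumSq σ)

  contribution-self : ∀ k m → contribution k m m ≡ p k m
  contribution-self k m with m ≟ m
  ... | yes _   = refl
  ... | no m≢m = contradiction refl m≢m

  contribution-other : ∀ k {m j} → m ≢ j → contribution k m j ≡ 0ℚ
  contribution-other k {m} {j} m≢j with m ≟ j
  ... | yes m≡j = contradiction m≡j m≢j
  ... | no _    = refl

  cost≡ : ∀ σ i → cost p σ i ≡ p i (σ i) + ½ * loadExcept σ i (σ i)
  cost≡ σ i = cong (λ t → p i (σ i) + ½ * t) (Σ-cong other≡)
    where
    other≡ : ∀ k → other p σ i k ≡ except i (λ k → contribution k (σ k) (σ i)) k
    other≡ k with k ≟ i | σ k ≟ σ i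
    ... | yes _ | _     = refl
    ... | no _  | yes _ = refl
    ... | no _  | no _  = refl

  load-self : ∀ σ i → load σ (σ i) ≡ p i (σ i) + loadExcept σ i (σ i)
  load-self σ i = trans (Σ-except _ i) (cong (_+ loadExcept σ i (σ i)) (contribution-self i (σ i)))

  load-other : ∀ σ i {j} → σ i ≢ j → load σ j ≡ loadExcept σ i j
  load-other σ i {j} σi≢j = trans (Σ-except _ i)
    (trans (cong (_+ loadExcept σ i j) (contribution-other i σi≢j)) (+-identityˡ (loadExcept σ i j)))

  potential-between : ∀ σ {a b} → a ≢ b → potential σ ≡ Φ (load σ a) (load σ b) (sumSq σ)
  potential-between σ {zero}       {zero}       a≢b = contradiction refl a≢b
  potential-between σ {zero}       {suc zero}   a≢b = refl
  potential-between σ {suc zero}   {zero}       a≢b = Φ-swap (load σ zero) (load σ (suc zero)) (sumSq σ)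
  potential-between σ {suc zero}   {suc zero}   a≢b = contradiction refl a≢b

  potential-at : ∀ σ i {j} → σ i ≢ j →
                 potential σ ≡ Φ (p i (σ i) + loadExcept σ i (σ i)) (loadExcept σ i j) (square σ i + sumSqExcept σ i)
  potential-at σ i {j} σi≢j = begin
    potential σ                                 ≡⟨ potential-between σ σi≢j ⟩
    Φ (load σ (σ i)) (load σ j) (sumSq σ)       ≡⟨ cong₂ (λ u v → Φ u v (sumSq σ)) (load-self σ i) (load-other σ i σi≢j) ⟩
    Φ (x + A) B (sumSq σ)                       ≡⟨ cong (Φ (x + A) B) (Σ-except (square σ) i) ⟩
    Φ (x + A) B (square σ i + sumSqExcept σ i)  ∎
    where
    open ≡-Reasoning
    x = p i (σ i)
    A = loadExcept σ i (σ i)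
    B = loadExcept σ i j

  module _ {σ σ' : Profile n} {i : Fin n} (unilateral : ∀ k → k ≢ i → σ' k ≡ σ k) where

    loadExcept-unilateral : ∀ j → loadExcept σ' i j ≡ loadExcept σ i j
    loadExcept-unilateral j = Σ-except-cong i λ k k≢i → cong (λ m → contribution k m j) (unilateral k k≢i)

    sumSqExcept-unilateral : sumSqExcept σ' i ≡ sumSqExcept σ i
    sumSqExcept-unilateral = Σ-except-cong i λ k k≢i → cong (λ m → p k m * p k m) (unilateral k k≢i)

    potential-move : σ' i ≢ σ i →
      potential σ + 4 * (p i (σ i) + p i (σ' i)) * cost p σ' i ≡
      potential σ' + 4 * (p i (σ i) + p i (σ' i)) * cost p σ i
    potential-move moved = begin
      potential σ + w * cost p σ' i              ≡⟨ cong₂ _+_ (potential-at σ i (moved ∘ sym)) (cong (w *_) cost-after) ⟩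
      Φ (x + A) B (x * x + R) + w * (y + ½ * B)  ≡⟨ Φ-move x y A B R ⟩
      Φ (y + B) A (y * y + R) + w * (x + ½ * A)  ≡⟨ cong₂ _+_ potential-after (cong (w *_) (cost≡ σ i)) ⟨
      potential σ' + w * cost p σ i              ∎
      where
      open ≡-Reasoning
      a = σ i
      b = σ' i
      x = p i a
      y = p i b
      w = 4 * (x + y)
      A = loadExcept σ i a
      B = loadExcept σ i b
      R = sumSqExcept σ i

      cost-after : cost p σ' i ≡ y + ½ * B
      cost-after = trans (cost≡ σ' i) (cong (λ t → y + ½ * t) (loadExcept-unilateral b))

      potential-after : potential σ' ≡ Φ (y + B) A (y * y + R)
      potential-after = begin
        potential σ'
          ≡⟨ potential-at σ' i moved ⟩
        Φ (y + loadExcept σ' i b) (loadExcept σ' i a) (y * y + sumSqExcept σ' i)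
          ≡⟨ cong₂ (λ u v → Φ (y + u) v (y * y + sumSqExcept σ' i))
                   (loadExcept-unilateral b) (loadExcept-unilateral a) ⟩
        Φ (y + B) A (y * y + sumSqExcept σ' i)
          ≡⟨ cong (λ r → Φ (y + B) A (y * y + r)) sumSqExcept-unilateral ⟩
        Φ (y + B) A (y * y + R)
          ∎

  potential-decreases : (∀ i j → 0ℚ < p i j) → ∀ {σ σ'} → BetterResponse p σ σ' → potential σ' < potential σ
  potential-decreases pos {σ} {σ'} (i , unilateral , moved , better) =
    +-cancelʳ-< (w * cost p σ i) (begin-strict
      potential σ' + w * cost p σ i  ≡⟨ potential-move unilateral moved ⟨
      potential σ + w * cost p σ' i  <⟨ +-monoʳ-< (potential σ) (*-monoʳ-<-pos w better) ⟩
      potential σ + w * cost p σ i   ∎)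
    where
    open ≤-Reasoning
    x = p i (σ i)
    y = p i (σ' i)
    w = 4 * (x + y)
    instance
      w-pos : Positive w
      w-pos = pos*pos⇒pos 4 (x + y) {{pos+pos⇒pos x {{positive (pos i (σ i))}} y {{positive (pos i (σ' i))}}}}

  potential-cong : ∀ {σ τ} → σ ≗ τ → potential σ ≡ potential τ
  potential-cong {σ} {τ} σ≗τ =
    trans (cong (Φ (load σ zero) (load σ (suc zero))) sumSq-cong)
          (cong₂ (λ u v → Φ u v (sumSq τ)) (load-cong zero) (load-cong (suc zero)))
    where
    load-cong : ∀ j → load σ j ≡ load τ j
    load-cong j = Σ-cong λ k → cong (λ m → contribution k m j) (σ≗τ k)
    sumSq-cong : sumSq σ ≡ sumSq τ
    sumSq-cong = Σ-cong λ k → cong (λ m → p k m * p k m) (σ≗τ k)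

  potential∈finiteImage : ∀ σ → potential σ ∈ map (potential ∘ finToFun) (allFin _)
  potential∈finiteImage σ = subst (_∈ _) (potential-cong (finToFun-funToFin σ))
                                  (∈-map⁺ (potential ∘ finToFun) (∈-allFin (funToFin σ)))

theorem2 : (n : ℕ) (p : Times n) → (∀ i j → 0ℚ < p i j) →
    (σ : Profile n) → Acc (flip (BetterResponse p)) σ
theorem2 n p pos = Subrelation.accessible (potential-decreases pos)
                 ∘ wellFounded-finiteImage potential potential∈finiteImage
  where open Potential p
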